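{- Let $G$ be a graph with minimum degree $\delta$ and circumference $c$, let $C$ be a longest cycle in $G$, and let $P$ be a longest path in $G\setminus V(C)$, with endpoints $x$ and $y$ and length $\overline{p}\ge 1$. Suppose $|N_C(x)|\ge 2$, $|N_C(y)|\ge 2$ and $N_C(x)\neq N_C(y)$. Put $\sigma_1=|N_C(x)\setminus N_C(y)|$ and $\sigma_2=|N_C(y)\setminus N_C(x)|$. Then $$ c\ge\begin{cases} 3\delta+\max\{\sigma_1,\sigma_2\}-1\ge 3\delta & \text{if } \overline{p}=1,\\ 4\delta-2\overline{p} & \text{if } \overline{p}\ge 2. \end{cases} $$
   Context: Graphs are finite, simple, undirected. The circumference $c$ is the length (number of edges) of a longest cycle. For a subgraph $H$ and vertex $v$, $N_H(v)=N(v)\cap V(H)$, where $N(v)$ is the neighborhood of $v$. $G\setminus V(C)$ is the subgraph induced by the vertices not on $C$. The length of a path is its number of edges. -}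

module Defs where

open import Data.Nat using (ℕ; zero; suc; _+_; _*_; _∸_; _≤_; _⊔_)
open import Data.Bool using (Bool; true; false; _∧_)
open import Data.Fin using (Fin)
open import Data.Fin.Properties using () renaming (_≟_ to _≟ᶠ_)
open import Data.Fin.Subset using (Subset; _∩_; _─_; ∣_∣)
open import Data.Vec using (tabulate)
open import Data.List using (List; []; _∷_; _++_; length)
open import Data.List.Relation.Unary.Linked using (Linked)
open import Data.List.Relation.Unary.Unique.Propositional using (Unique)
open import Data.List.Relation.Unary.All using (All)
open import Data.List.Membership.Propositional using (_∈_; _∉_)
import Data.List.Membership.DecPropositional as DecMem
open import Data.Product using (Σ; ∃; _×_)
open import Data.Empty using (⊥)
open import Relation.Nullary.Decidable using (⌊_⌋)
open import Relation.Binary.PropositionalEquality using (_≡_)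

record Graph (n : ℕ) : Set where
  field
    adj    : Fin n → Fin n → Bool
    sym    : ∀ u v → adj u v ≡ adj v u
    irrefl : ∀ v → adj v v ≡ false
open Graph public

module _ {n : ℕ} (G : Graph n) where

  Adj : Fin n → Fin n → Set
  Adj u v = adj G u v ≡ true

  N : Fin n → Subset n
  N v = tabulate (adj G v)

  deg : Fin n → ℕ
  deg v = ∣ N v ∣

  IsMinDegree : ℕ → Set
  IsMinDegree δ = (∀ v → δ ≤ deg v) × ∃ λ v → deg v ≡ δ

  IsPath : List (Fin n) → Set
  IsPath [] = ⊥
  IsPath (v ∷ vs) = Unique (v ∷ vs) × Linked Adj (v ∷ vs)

  pathLength : List (Fin n) → ℕ
  pathLength vs = length vs ∸ 1

  -- a cycle v₀ v₁ … v_{k-1} (k ≥ 3 distinct vertices, v_{k-1} v₀ an edge);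
  -- its length (number of edges) is k = length of the list
  IsCycle : List (Fin n) → Set
  IsCycle [] = ⊥
  IsCycle (v ∷ vs) =
    Unique (v ∷ vs) × Linked Adj ((v ∷ vs) ++ (v ∷ [])) × 3 ≤ length (v ∷ vs)

  IsCircumference : ℕ → Set
  IsCircumference c =
    (Σ (List (Fin n)) λ C → IsCycle C × length C ≡ c)
    × (∀ C → IsCycle C → length C ≤ c)

  IsLongestCycle : List (Fin n) → Set
  IsLongestCycle C = IsCycle C × (∀ C′ → IsCycle C′ → length C′ ≤ length C)

  IsPathOutside : List (Fin n) → List (Fin n) → Set
  IsPathOutside C P = IsPath P × All (λ v → v ∉ C) P

  IsLongestPathOutside : List (Fin n) → List (Fin n) → Set
  IsLongestPathOutside C P =
    IsPathOutside C P
    × (∀ Q → IsPathOutside C Q → pathLength Q ≤ pathLength P)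

  HasEnds : List (Fin n) → Fin n → Fin n → Set
  HasEnds P x y = Σ (List (Fin n)) λ mid → P ≡ x ∷ (mid ++ (y ∷ []))

  VSet : List (Fin n) → Subset n
  VSet C = tabulate (λ v → ⌊ DecMem._∈?_ (_≟ᶠ_ {n}) v C ⌋)

  NC : List (Fin n) → Fin n → Subset n
  NC C v = N v ∩ VSet C

module Submission where

-- Write A = N_C(x), B = N_C(y), p for the length of P, and label each vertex of C in A ∪ B
-- as onlyA, onlyB or both. Two labelled vertices u, w of C are at distance at least p + 2
-- along C when u ∈ A and w ∈ B or vice versa ("mixed"), since otherwise rerouting C through
-- P would give a longer cycle, and at distance at least 2 otherwise, by rerouting C through x
-- or through y. Going once around C, every vertex of kind both and the last vertex of every
-- run of onlyA or of onlyB starts a mixed gap, so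
-- c ≥ (p + 2)|A ∩ B| + 2(σ₁ + σ₂) + p(min(1, σ₁) + min(1, σ₂)). All neighbours of x and of y
-- off C lie on P, so δ ≤ |A| + p and δ ≤ |B| + p, and the two bounds follow by arithmetic.

open import Defs hiding (sym)

open import Data.Bool using (Bool; true; false; _∧_; _∨_; not; if_then_else_)
open import Data.Bool.Properties using (∧-comm; ∨-comm; ∧-zeroʳ; ∧-identityʳ) renaming (_≟_ to _≟ᵇ_)
open import Data.Empty using (⊥; ⊥-elim)
open import Data.Fin using (Fin; zero; suc)
open import Data.Fin.Subset using (Subset; _∩_; _─_; ∣_∣; inside; outside)
open import Data.Fin.Subset.Properties using (∩-comm)
open import Data.List using (List; []; _∷_; _++_; [_]; length; reverse; mapMaybe)
open import Data.List.Properties using (++-assoc; ++-identityʳ; length-++; length-reverse; reverse-++; unfold-reverse)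
open import Data.List.Relation.Unary.All as All using (All; []; _∷_)
import Data.List.Relation.Unary.All.Properties as All
open import Data.List.Relation.Unary.Any using (here; there)
open import Data.List.Relation.Unary.Linked using (Linked; []; [-]; _∷_)
open import Data.List.Relation.Unary.Unique.Propositional using (Unique; []; _∷_)
import Data.List.Relation.Unary.Unique.Propositional.Properties as Unique
open import Data.List.Relation.Binary.Permutation.Propositional using (_↭_; ↭⇒↭ₛ; ↭-sym; ↭-refl; ↭-trans)
import Data.List.Relation.Binary.Permutation.Propositional.Properties as ↭
import Data.List.Relation.Binary.Permutation.Setoid.Properties as ↭ₛ
open import Data.List.Membership.Propositional using (_∈_; _∉_)
import Data.List.Membership.DecPropositional as DecMembership
open import Data.List.Membership.Propositional.Properties using (∈-++⁺ˡ; ∈-++⁻; ∈-∃++)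
open import Data.Maybe using (Maybe; just; nothing)
open import Data.Nat using (ℕ; zero; suc; _+_; _*_; _≤_; _⊔_; _⊓_; z≤n; s≤s; s≤s⁻¹)
open import Data.Nat.Properties hiding (_≟_)
open import Data.Nat.Tactic.RingSolver using (solve-∀)
open import Data.Vec using ([]; _∷_; lookup; tabulate; _[_]≔_)
open import Data.Vec.Properties using (lookup∘update; lookup∘update′; lookup∘tabulate; lookup-zipWith)
open import Data.Product using (∃; _×_; _,_; proj₁; proj₂)
open import Data.Sum using (_⊎_; inj₁; inj₂)
open import Function using (_∘_; case_of_)
open import Level using (0ℓ)
open import Relation.Binary.Core using (Rel)
open import Relation.Binary.PropositionalEquality hiding ([_])
open import Relation.Nullary using (¬_; yes; no; contradiction)
open import Relation.Nullary.Decidable using (⌊_⌋)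
open import Data.Fin.Properties using (_≟_)

module _ {A : Set} where

  Unique-resp-↭ : ∀ {xs ys : List A} → xs ↭ ys → Unique xs → Unique ys
  Unique-resp-↭ p = ↭ₛ.Unique-resp-↭ (setoid A) (↭⇒↭ₛ p)

  Unique-++⁻ˡ : ∀ (xs : List A) {ys} → Unique (xs ++ ys) → Unique xs
  Unique-++⁻ˡ []       _       = []
  Unique-++⁻ˡ (x ∷ xs) (d ∷ u) = All.++⁻ˡ xs d ∷ Unique-++⁻ˡ xs u

  Unique-reverse : ∀ {xs : List A} → Unique xs → Unique (reverse xs)
  Unique-reverse {xs} = Unique-resp-↭ (↭-sym (↭.↭-reverse xs))

module _ {A : Set} {R : Rel A 0ℓ} where

  Linked-++⁻ˡ : ∀ (xs : List A) {ys} → Linked R (xs ++ ys) → Linked R xs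
  Linked-++⁻ˡ []           _       = []
  Linked-++⁻ˡ (x ∷ [])     _       = [-]
  Linked-++⁻ˡ (x ∷ y ∷ xs) (r ∷ l) = r ∷ Linked-++⁻ˡ (y ∷ xs) l

  Linked-++⁻ʳ : ∀ (xs : List A) {ys} → Linked R (xs ++ ys) → Linked R ys
  Linked-++⁻ʳ []           l       = l
  Linked-++⁻ʳ (x ∷ [])     {[]} _  = []
  Linked-++⁻ʳ (x ∷ [])     {_ ∷ _} (_ ∷ l) = l
  Linked-++⁻ʳ (x ∷ y ∷ xs) (_ ∷ l) = Linked-++⁻ʳ (y ∷ xs) l

  Linked-join : ∀ (xs : List A) a {ys} → Linked R (xs ++ [ a ]) → Linked R (a ∷ ys) → Linked R (xs ++ a ∷ ys)
  Linked-join []           a _       l = l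
  Linked-join (x ∷ [])     a (r ∷ _) l = r ∷ l
  Linked-join (x ∷ y ∷ xs) a (r ∷ k) l = r ∷ Linked-join (y ∷ xs) a k l

  Linked-reverse : (∀ {u v} → R u v → R v u) → ∀ {xs} → Linked R xs → Linked R (reverse xs)
  Linked-reverse sym {[]}         _       = []
  Linked-reverse sym {x ∷ []}     _       = [-]
  Linked-reverse sym {x ∷ y ∷ xs} (r ∷ l) =
    subst (Linked R) reverse-eq (Linked-join (reverse xs) y rev-tail (sym r ∷ [-]))
    where
    rev-tail : Linked R (reverse xs ++ [ y ])
    rev-tail = subst (Linked R) (unfold-reverse y xs) (Linked-reverse sym l)
    reverse-eq : reverse xs ++ y ∷ [ x ] ≡ reverse (x ∷ y ∷ xs)
    reverse-eq = begin
      reverse xs ++ y ∷ [ x ]     ≡⟨ ++-assoc (reverse xs) [ y ] [ x ] ⟨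
      (reverse xs ++ [ y ]) ++ [ x ] ≡⟨ cong (_++ [ x ]) (unfold-reverse y xs) ⟨
      reverse (y ∷ xs) ++ [ x ]   ≡⟨ unfold-reverse x (y ∷ xs) ⟨
      reverse (x ∷ y ∷ xs)        ∎
      where open ≡-Reasoning

length-reverse-∷ʳ : ∀ {A : Set} (xs : List A) a b → length (reverse xs ++ [ a ]) ≡ length (xs ++ [ b ])
length-reverse-∷ʳ xs a b = begin
  length (reverse xs ++ [ a ])  ≡⟨ length-++ (reverse xs) ⟩
  length (reverse xs) + 1       ≡⟨ cong (_+ 1) (length-reverse xs) ⟩
  length xs + 1                 ≡⟨ length-++ xs ⟨
  length (xs ++ [ b ])          ∎
  where open ≡-Reasoning

∈-split : ∀ {A : Set} {u w : A} {xs} → u ∈ xs → w ∈ xs → u ≢ w →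
  (∃ λ pre → ∃ λ mid → ∃ λ post → xs ≡ pre ++ u ∷ mid ++ w ∷ post) ⊎
  (∃ λ pre → ∃ λ mid → ∃ λ post → xs ≡ pre ++ w ∷ mid ++ u ∷ post)
∈-split u∈ w∈ u≢w with ∈-∃++ u∈
... | pre , post , refl with ∈-++⁻ pre w∈
...   | inj₁ w∈pre with pre′ , mid , refl ← ∈-∃++ w∈pre =
  inj₂ (pre′ , mid , post , ++-assoc pre′ (_ ∷ mid) (_ ∷ post))
...   | inj₂ (here w≡u) = ⊥-elim (u≢w (sym w≡u))
...   | inj₂ (there w∈post) with mid , post′ , refl ← ∈-∃++ w∈post = inj₁ (pre , mid , post′ , refl)

∈-∷-≢ : ∀ {A : Set} {v w : A} {xs} → w ∈ v ∷ xs → w ≢ v → w ∈ xs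
∈-∷-≢ (here w≡v)  w≢v = ⊥-elim (w≢v w≡v)
∈-∷-≢ (there w∈xs) _  = w∈xs

count : {A : Set} → (A → Bool) → List A → ℕ
count P []       = 0
count P (x ∷ xs) = if P x then suc (count P xs) else count P xs

count≤length : ∀ {A : Set} (P : A → Bool) xs → count P xs ≤ length xs
count≤length P []       = z≤n
count≤length P (x ∷ xs) with P x
... | true  = s≤s (count≤length P xs)
... | false = m≤n⇒m≤1+n (count≤length P xs)

count-mono : ∀ {A : Set} {P Q : A → Bool} → (∀ x → P x ≡ true → Q x ≡ true) → ∀ xs → count P xs ≤ count Q xs
count-mono P⇒Q []       = z≤n
count-mono {P = P} {Q} P⇒Q (x ∷ xs) with P x in px | Q x in qx
... | true  | true  = s≤s (count-mono P⇒Q xs)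
... | true  | false = case trans (sym (P⇒Q x px)) qx of λ ()
... | false | true  = m≤n⇒m≤1+n (count-mono P⇒Q xs)
... | false | false = count-mono P⇒Q xs

∧⁻ : ∀ {a b} → a ∧ b ≡ true → a ≡ true × b ≡ true
∧⁻ {true} {true} _ = refl , refl

∧-not⁻ : ∀ {a b} → a ∧ not b ≡ true → a ≡ true × b ≡ false
∧-not⁻ {true} {false} _ = refl , refl

∣p∣≡∣p∩q∣+∣p─q∣ : ∀ {n} (p q : Subset n) → ∣ p ∣ ≡ ∣ p ∩ q ∣ + ∣ p ─ q ∣
∣p∣≡∣p∩q∣+∣p─q∣ []            []            = refl
∣p∣≡∣p∩q∣+∣p─q∣ (inside  ∷ p) (inside  ∷ q) = cong suc (∣p∣≡∣p∩q∣+∣p─q∣ p q)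
∣p∣≡∣p∩q∣+∣p─q∣ (inside  ∷ p) (outside ∷ q) = trans (cong suc (∣p∣≡∣p∩q∣+∣p─q∣ p q)) (sym (+-suc _ _))
∣p∣≡∣p∩q∣+∣p─q∣ (outside ∷ p) (inside  ∷ q) = ∣p∣≡∣p∩q∣+∣p─q∣ p q
∣p∣≡∣p∩q∣+∣p─q∣ (outside ∷ p) (outside ∷ q) = ∣p∣≡∣p∩q∣+∣p─q∣ p q

lookup-─ : ∀ {n} (p q : Subset n) v → lookup (p ─ q) v ≡ lookup p v ∧ not (lookup q v)
lookup-─ (x ∷ p) (inside  ∷ q) zero    = sym (∧-zeroʳ x)
lookup-─ (x ∷ p) (outside ∷ q) zero    = sym (∧-identityʳ x)
lookup-─ (x ∷ p) (_       ∷ q) (suc v) = lookup-─ p q v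

∣p∣≡1+∣p[v]≔outside∣ : ∀ {n} (p : Subset n) {v} → lookup p v ≡ true → ∣ p ∣ ≡ suc ∣ p [ v ]≔ outside ∣
∣p∣≡1+∣p[v]≔outside∣ (inside  ∷ p) {zero}  _  = refl
∣p∣≡1+∣p[v]≔outside∣ (inside  ∷ p) {suc v} pv = cong suc (∣p∣≡1+∣p[v]≔outside∣ p pv)
∣p∣≡1+∣p[v]≔outside∣ (outside ∷ p) {suc v} pv = ∣p∣≡1+∣p[v]≔outside∣ p pv

∣p∣≤count : ∀ {n} (p : Subset n) L → (∀ v → lookup p v ≡ true → v ∈ L) → ∣ p ∣ ≤ count (lookup p) L
∣p∣≤count p [] p⊆L = ≤-reflexive (empty p λ v pv → case p⊆L v pv of λ ())
  where
  empty : ∀ {m} (p : Subset m) → (∀ v → lookup p v ≡ true → ⊥) → ∣ p ∣ ≡ 0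
  empty []            _  = refl
  empty (inside  ∷ p) ∉p = ⊥-elim (∉p zero refl)
  empty (outside ∷ p) ∉p = empty p (∉p ∘ suc)
∣p∣≤count p (v ∷ L) p⊆L with lookup p v in pv
... | false = ∣p∣≤count p L (λ w pw → ∈-∷-≢ (p⊆L w pw) (λ { refl → case trans (sym pv) pw of λ () }))
... | true  = begin
  ∣ p ∣                        ≡⟨ ∣p∣≡1+∣p[v]≔outside∣ p pv ⟩
  suc ∣ p′ ∣                   ≤⟨ s≤s (∣p∣≤count p′ L p′⊆L) ⟩
  suc (count (lookup p′) L)    ≤⟨ s≤s (count-mono p′⊆p L) ⟩
  suc (count (lookup p) L)     ∎
  where
  open ≤-Reasoning
  p′ = p [ v ]≔ outside
  p′v : lookup p′ v ≡ false
  p′v = lookup∘update v p outside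
  p′⊆p : ∀ w → lookup p′ w ≡ true → lookup p w ≡ true
  p′⊆p w p′w with w ≟ v
  ... | yes refl = case trans (sym p′v) p′w of λ ()
  ... | no w≢v   = trans (sym (lookup∘update′ w≢v p outside)) p′w
  p′⊆L : ∀ w → lookup p′ w ≡ true → w ∈ L
  p′⊆L w p′w = ∈-∷-≢ (p⊆L w (p′⊆p w p′w)) (λ { refl → case trans (sym p′v) p′w of λ () })

member⇒1≤∣p∣ : ∀ {n} (p : Subset n) {v} → lookup p v ≡ true → 1 ≤ ∣ p ∣
member⇒1≤∣p∣ p pv = subst (1 ≤_) (sym (∣p∣≡1+∣p[v]≔outside∣ p pv)) (s≤s z≤n)

1≤∣p∣⇒member : ∀ {n} (p : Subset n) → 1 ≤ ∣ p ∣ → ∃ λ v → lookup p v ≡ true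
1≤∣p∣⇒member (inside  ∷ p) _ = zero , refl
1≤∣p∣⇒member (outside ∷ p) h = let v , pv = 1≤∣p∣⇒member p h in suc v , pv

≢⇒differing : ∀ {n} (p q : Subset n) → p ≢ q → ∃ λ v → lookup p v ≢ lookup q v
≢⇒differing [] [] p≢q = ⊥-elim (p≢q refl)
≢⇒differing (a ∷ p) (b ∷ q) p≢q with a ≟ᵇ b
... | no a≢b   = zero , a≢b
... | yes refl = let v , d = ≢⇒differing p q (p≢q ∘ cong (a ∷_)) in suc v , d

-- Cyclic words over the kinds of labelled vertices

data Kind : Set where
  onlyA onlyB both : Kind

inA inB : Kind → Bool
inA onlyB = false
inA _     = true
inB onlyA = false
inB _     = true

mixed : Kind → Kind → Bool
mixed k l = (inA k ∧ inB l) ∨ (inB k ∧ inA l)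

mixed-comm : ∀ k l → mixed k l ≡ mixed l k
mixed-comm k l = trans (cong₂ _∨_ (∧-comm (inA k) (inB l)) (∧-comm (inB k) (inA l))) (∨-comm (inB l ∧ inA k) _)

unmixed⇒≡ : ∀ {k l} → mixed k l ≡ false → k ≡ l
unmixed⇒≡ {onlyA} {onlyA} _  = refl
unmixed⇒≡ {onlyA} {onlyB} ()
unmixed⇒≡ {onlyA} {both}  ()
unmixed⇒≡ {onlyB} {onlyA} ()
unmixed⇒≡ {onlyB} {onlyB} _  = refl
unmixed⇒≡ {onlyB} {both}  ()
unmixed⇒≡ {both}  {onlyA} ()
unmixed⇒≡ {both}  {onlyB} ()
unmixed⇒≡ {both}  {both}  ()

_==_ : Kind → Kind → Bool
onlyA == onlyA = true
onlyB == onlyB = true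
both  == both  = true
_     == _     = false

#both #onlyA #onlyB : List Kind → ℕ
#both  = count (_== both)
#onlyA = count (_== onlyA)
#onlyB = count (_== onlyB)

length≡#both+#onlyA+#onlyB : ∀ ks → length ks ≡ #both ks + #onlyA ks + #onlyB ks
length≡#both+#onlyA+#onlyB []         = refl
length≡#both+#onlyA+#onlyB (onlyA ∷ ks) =
  trans (cong suc (length≡#both+#onlyA+#onlyB ks)) (cong (_+ #onlyB ks) (sym (+-suc (#both ks) _)))
length≡#both+#onlyA+#onlyB (onlyB ∷ ks) =
  trans (cong suc (length≡#both+#onlyA+#onlyB ks)) (sym (+-suc (#both ks + #onlyA ks) _))
length≡#both+#onlyA+#onlyB (both  ∷ ks) = cong suc (length≡#both+#onlyA+#onlyB ks)

hasKind : Kind → Maybe Kind → Bool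
hasKind k (just l) = l == k
hasKind k nothing  = false

count-mapMaybe : ∀ {A : Set} k (f : A → Maybe Kind) xs → count (_== k) (mapMaybe f xs) ≡ count (hasKind k ∘ f) xs
count-mapMaybe k f []       = refl
count-mapMaybe k f (x ∷ xs) with f x
... | nothing = count-mapMaybe k f xs
... | just l with l == k
...   | true  = cong suc (count-mapMaybe k f xs)
...   | false = count-mapMaybe k f xs

mixedPairs : Kind → List Kind → ℕ
mixedPairs k []       = 0
mixedPairs k (l ∷ ls) = if mixed k l then suc (mixedPairs l ls) else mixedPairs l ls

forcedMixed : List Kind → ℕ
forcedMixed ks = #both ks + 1 ⊓ #onlyA ks + 1 ⊓ #onlyB ks

forcedMixed-step : ∀ k l ls →
  forcedMixed (k ∷ l ∷ ls) ≤ (if mixed k l then suc (forcedMixed (l ∷ ls)) else forcedMixed (l ∷ ls))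
forcedMixed-step onlyA onlyA ls = ≤-refl
forcedMixed-step onlyA onlyB ls = ≤-trans (m≤m+n _ _) (≤-reflexive (swap (#both ls) (1 ⊓ #onlyA ls)))
  where
  swap : ∀ b x → b + 1 + 1 + x ≡ suc (b + x + 1)
  swap = solve-∀
forcedMixed-step onlyA both  ls = ≤-trans (m≤m+n _ _) (≤-reflexive (swap (#both ls) (1 ⊓ #onlyA ls) (1 ⊓ #onlyB ls)))
  where
  swap : ∀ b x y → suc b + 1 + y + x ≡ suc (suc b + x + y)
  swap = solve-∀
forcedMixed-step onlyB onlyA ls = ≤-trans (m≤m+n _ _) (≤-reflexive (swap (#both ls) (1 ⊓ #onlyB ls)))
  where
  swap : ∀ b y → b + 1 + 1 + y ≡ suc (b + 1 + y)
  swap = solve-∀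
forcedMixed-step onlyB onlyB ls = ≤-refl
forcedMixed-step onlyB both  ls = ≤-trans (m≤m+n _ _) (≤-reflexive (swap (#both ls) (1 ⊓ #onlyA ls) (1 ⊓ #onlyB ls)))
  where
  swap : ∀ b x y → suc b + x + 1 + y ≡ suc (suc b + x + y)
  swap = solve-∀
forcedMixed-step both  onlyA ls = ≤-refl
forcedMixed-step both  onlyB ls = ≤-refl
forcedMixed-step both  both  ls = ≤-refl

-- Every pair starting at a vertex of kind both is mixed, and so is the pair leaving each
-- maximal run of onlyA or of onlyB except possibly the last run; the +1 pays for that one.
mixedPairs-lowerBound : ∀ k ks → forcedMixed (k ∷ ks) ≤ suc (mixedPairs k ks)
mixedPairs-lowerBound onlyA []       = ≤-refl
mixedPairs-lowerBound onlyB []       = ≤-refl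
mixedPairs-lowerBound both  []       = ≤-refl
mixedPairs-lowerBound k     (l ∷ ls) with mixed k l | forcedMixed-step k l ls
... | true  | le = ≤-trans le (s≤s (mixedPairs-lowerBound l ls))
... | false | le = ≤-trans le (mixedPairs-lowerBound l ls)

walkWeight : {K : Set} → (K → K → ℕ) → K → List K → ℕ
walkWeight g k []       = 0
walkWeight g k (l ∷ ls) = g k l + walkWeight g l ls

spacing : ℕ → Kind → Kind → ℕ
spacing p k l = if mixed k l then 2 + p else 2

spacing-mixed : ∀ p {k l} → mixed k l ≡ true → spacing p k l ≡ 2 + p
spacing-mixed p e rewrite e = refl

walkWeight-spacing : ∀ p k ks → walkWeight (spacing p) k ks ≡ 2 * length ks + p * mixedPairs k ks
walkWeight-spacing p k []       = sym (*-zeroʳ p)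
walkWeight-spacing p k (l ∷ ls) with mixed k l
... | true  = trans (cong (2 + p +_) (walkWeight-spacing p l ls)) (step p (length ls) (mixedPairs l ls))
  where
  step : ∀ p n m → 2 + p + (2 * n + p * m) ≡ 2 * suc n + p * suc m
  step = solve-∀
... | false = trans (cong (2 +_) (walkWeight-spacing p l ls)) (step p (length ls) (mixedPairs l ls))
  where
  step : ∀ p n m → 2 + (2 * n + p * m) ≡ 2 * suc n + p * m
  step = solve-∀

cycleLowerBound : ℕ → ℕ → ℕ → ℕ → ℕ
cycleLowerBound p s α β = (2 + p) * s + 2 * (α + β) + p * (1 ⊓ α + 1 ⊓ β)

cycleLowerBound-mono : ∀ p {s s′ α α′ β β′} → s ≤ s′ → α ≤ α′ → β ≤ β′ →
  cycleLowerBound p s α β ≤ cycleLowerBound p s′ α′ β′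
cycleLowerBound-mono p s≤ α≤ β≤ = +-mono-≤ (+-mono-≤ (*-monoʳ-≤ (2 + p) s≤) (*-monoʳ-≤ 2 (+-mono-≤ α≤ β≤)))
  (*-monoʳ-≤ p (+-mono-≤ (⊓-monoʳ-≤ 1 α≤) (⊓-monoʳ-≤ 1 β≤)))

cycleLowerBound-comm : ∀ p s α β → cycleLowerBound p s α β ≡ cycleLowerBound p s β α
cycleLowerBound-comm p s α β = cong₂ (λ a b → (2 + p) * s + 2 * a + p * b) (+-comm α β) (+-comm (1 ⊓ α) (1 ⊓ β))

-- The right-hand side is the weight of the closed walk k ks k whose closing pair is mixed.
spacing-cyclic-lowerBound : ∀ p k ks →
  cycleLowerBound p (#both (k ∷ ks)) (#onlyA (k ∷ ks)) (#onlyB (k ∷ ks)) ≤ walkWeight (spacing p) k ks + (2 + p)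
spacing-cyclic-lowerBound p k ks = begin
  (2 + p) * b + 2 * (a + c) + p * (1 ⊓ a + 1 ⊓ c)  ≡⟨ regroup p b a c (1 ⊓ a) (1 ⊓ c) ⟩
  2 * (b + a + c) + p * forcedMixed (k ∷ ks)
    ≡⟨ cong (λ n → 2 * n + p * forcedMixed (k ∷ ks)) (length≡#both+#onlyA+#onlyB (k ∷ ks)) ⟨
  2 * suc (length ks) + p * forcedMixed (k ∷ ks)
    ≤⟨ +-monoʳ-≤ (2 * suc (length ks)) (*-monoʳ-≤ p (mixedPairs-lowerBound k ks)) ⟩
  2 * suc (length ks) + p * suc (mixedPairs k ks)    ≡⟨ close p (length ks) (mixedPairs k ks) ⟩
  (2 * length ks + p * mixedPairs k ks) + (2 + p)    ≡⟨ cong (_+ (2 + p)) (walkWeight-spacing p k ks) ⟨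
  walkWeight (spacing p) k ks + (2 + p)              ∎
  where
  open ≤-Reasoning
  b = #both (k ∷ ks)
  a = #onlyA (k ∷ ks)
  c = #onlyB (k ∷ ks)
  regroup : ∀ p b a c x y → (2 + p) * b + 2 * (a + c) + p * (x + y) ≡ 2 * (b + a + c) + p * (b + x + y)
  regroup = solve-∀
  close : ∀ p n m → 2 * suc n + p * suc m ≡ (2 * n + p * m) + (2 + p)
  close = solve-∀

classify : Bool → Bool → Maybe Kind
classify true  true  = just both
classify true  false = just onlyA
classify false true  = just onlyB
classify false false = nothing

classify-just : ∀ {a b k} → classify a b ≡ just k → a ≡ inA k × b ≡ inB k
classify-just {true}  {true}  refl = refl , refl
classify-just {true}  {false} refl = refl , refl
classify-just {false} {true}  refl = refl , refl

classify-∩ : ∀ a b → a ∧ b ≡ hasKind both (classify a b)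
classify-∩ true  true  = refl
classify-∩ true  false = refl
classify-∩ false true  = refl
classify-∩ false false = refl

classify-─ : ∀ a b → a ∧ not b ≡ hasKind onlyA (classify a b)
classify-─ true  true  = refl
classify-─ true  false = refl
classify-─ false true  = refl
classify-─ false false = refl

classify-flip-─ : ∀ a b → b ∧ not a ≡ hasKind onlyB (classify a b)
classify-flip-─ true  true  = refl
classify-flip-─ true  false = refl
classify-flip-─ false true  = refl
classify-flip-─ false false = refl

module Labelling {V K : Set} (label : V → Maybe K) where

  Unlabelled : List V → Set
  Unlabelled = All (λ v → label v ≡ nothing)

  Spaced : (K → K → ℕ) → List V → Set
  Spaced g L = ∀ pre u mid w post {k l} → L ≡ pre ++ u ∷ mid ++ w ∷ post →
    label u ≡ just k → label w ≡ just l → g k l ≤ suc (length mid)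

  Spaced-++⁻ˡ : ∀ {g} xs {ys} → Spaced g (xs ++ ys) → Spaced g xs
  Spaced-++⁻ˡ xs {ys} sp pre u mid w post eq = sp pre u mid w (post ++ ys) (begin
    xs ++ ys                                   ≡⟨ cong (_++ ys) eq ⟩
    (pre ++ u ∷ mid ++ w ∷ post) ++ ys         ≡⟨ ++-assoc pre (u ∷ mid ++ w ∷ post) ys ⟩
    pre ++ u ∷ (mid ++ w ∷ post) ++ ys         ≡⟨ cong (λ t → pre ++ u ∷ t) (++-assoc mid (w ∷ post) ys) ⟩
    pre ++ u ∷ mid ++ w ∷ post ++ ys           ∎)
    where open ≡-Reasoning

  Spaced-++⁻ʳ : ∀ {g} xs {ys} → Spaced g (xs ++ ys) → Spaced g ys
  Spaced-++⁻ʳ xs sp pre u mid w post eq =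
    sp (xs ++ pre) u mid w post (trans (cong (xs ++_) eq) (sym (++-assoc xs pre _)))

  Spaced⇒walkWeight≤length : ∀ {g u k} L → label u ≡ just k → Spaced g (u ∷ L) →
    walkWeight g k (mapMaybe label L) ≤ length L
  Spaced⇒walkWeight≤length {g} L lu sp = go [] L lu sp
    where
    go : ∀ {u k} M L → label u ≡ just k → Spaced g (u ∷ M ++ L) →
      walkWeight g k (mapMaybe label L) ≤ length M + length L
    go M []      _  _  = z≤n
    go M (v ∷ L) lu sp with label v in lv
    ... | nothing = ≤-trans (go (M ++ [ v ]) L lu (subst (Spaced g) (cong (_ ∷_) (sym (++-assoc M [ v ] L))) sp))
                              (≤-reflexive (trans (cong (_+ length L) (length-++ M)) (+-assoc (length M) 1 (length L))))
    ... | just l  = ≤-trans (+-mono-≤ (sp [] _ M v L refl lu lv) (go [] L lv (Spaced-++⁻ʳ (_ ∷ M) sp)))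
                              (≤-reflexive (sym (+-suc (length M) (length L))))

module MixedGaps {V : Set} (label : V → Maybe Kind) where

  open Labelling label

  record MixedGap (L : List V) : Set where
    field
      pre mid post : List V
      u w          : V
      k l          : Kind
      split        : L ≡ pre ++ u ∷ mid ++ w ∷ post
      label-u      : label u ≡ just k
      label-w      : label w ≡ just l
      unlabelled   : Unlabelled mid
      kl-mixed     : mixed k l ≡ true

  -- Scan from u towards w: a labelled vertex not mixed with u has u's label, so it is still
  -- mixed with w and the scan can restart from it; it stops at a consecutive mixed pair.
  mixedGap : ∀ {L} pre u mid w post {k l} → L ≡ pre ++ u ∷ mid ++ w ∷ post →
    label u ≡ just k → label w ≡ just l → mixed k l ≡ true → MixedGap L
  mixedGap pre u mid w post eq = go pre u [] mid w post eq []
    where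
    go : ∀ {L} pre u nz mid w post {k l} → L ≡ pre ++ u ∷ nz ++ mid ++ w ∷ post → Unlabelled nz →
      label u ≡ just k → label w ≡ just l → mixed k l ≡ true → MixedGap L
    go pre u nz [] w post eq unz lu lw m = record
      { split = eq ; label-u = lu ; label-w = lw ; unlabelled = unz ; kl-mixed = m }
    go pre u nz (z ∷ mid) w post {k} eq unz lu lw m with label z in lz
    ... | nothing = go pre u (nz ++ [ z ]) mid w post
                      (trans eq (cong (λ t → pre ++ u ∷ t) (sym (++-assoc nz [ z ] _)))) (All.++⁺ unz (lz ∷ [])) lu lw m
    ... | just k′ with mixed k k′ in m′
    ...   | true  = record
      { split = eq ; label-u = lu ; label-w = lz ; unlabelled = unz ; kl-mixed = m′ }
    ...   | false with refl ← unmixed⇒≡ {k} {k′} m′ = go (pre ++ u ∷ nz) z [] mid w post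
                      (trans eq (sym (++-assoc pre (u ∷ nz) _))) [] lz lw m

-- Cycles and longest paths

module Cycles {n : ℕ} (G : Graph n) where

  Adj-sym : ∀ {u v} → Adj G u v → Adj G v u
  Adj-sym {u} {v} e = trans (Graph.sym G v u) e

  Adj-irrefl : ∀ {v} → ¬ Adj G v v
  Adj-irrefl {v} e = case trans (sym e) (irrefl G v) of λ ()

  IsCycle-rotate : ∀ xs ys → IsCycle G (xs ++ ys) → IsCycle G (ys ++ xs)
  IsCycle-rotate []       ys       c = subst (IsCycle G) (sym (++-identityʳ ys)) c
  IsCycle-rotate (x ∷ xs) []       c = subst (IsCycle G) (++-identityʳ (x ∷ xs)) c
  IsCycle-rotate (x ∷ xs) (y ∷ ys) (u , l , len) =
    Unique-resp-↭ (↭.++-comm (x ∷ xs) (y ∷ ys)) u ,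
    subst (Linked (Adj G)) (sym (++-assoc (y ∷ ys) (x ∷ xs) [ y ])) (Linked-join (y ∷ ys) x from-y from-x) ,
    subst (3 ≤_) (trans (length-++ (x ∷ xs)) (trans (+-comm (length (x ∷ xs)) _) (sym (length-++ (y ∷ ys))))) len
    where
    l′ : Linked (Adj G) ((x ∷ xs) ++ (y ∷ ys) ++ [ x ])
    l′ = subst (Linked (Adj G)) (++-assoc (x ∷ xs) (y ∷ ys) [ x ]) l
    from-y : Linked (Adj G) ((y ∷ ys) ++ [ x ])
    from-y = Linked-++⁻ʳ (x ∷ xs) l′
    from-x : Linked (Adj G) (x ∷ xs ++ [ y ])
    from-x = Linked-++⁻ˡ ((x ∷ xs) ++ [ y ]) (subst (Linked (Adj G)) (sym (++-assoc (x ∷ xs) [ y ] (ys ++ [ x ]))) l′)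

  IsCycle-close : ∀ b rest a {Q} → Unique (b ∷ rest ++ [ a ]) → Linked (Adj G) (b ∷ rest ++ [ a ]) →
    Unique Q → Linked (Adj G) (a ∷ Q ++ [ b ]) → (∀ {v} → v ∈ Q → v ∉ b ∷ rest ++ [ a ]) → 1 ≤ length Q →
    IsCycle G (b ∷ rest ++ a ∷ Q)
  IsCycle-close b rest a {Q} u l uQ lQ disj 1≤Q =
    subst Unique (++-assoc (b ∷ rest) [ a ] Q) (Unique.++⁺ u uQ (λ (v∈ , v∈Q) → disj v∈Q v∈)) ,
    subst (Linked (Adj G)) (cong (b ∷_) (sym (++-assoc rest (a ∷ Q) [ b ]))) (Linked-join (b ∷ rest) a l lQ) ,
    s≤s (subst (2 ≤_) (sym (length-++ rest)) (≤-trans (s≤s 1≤Q) (m≤n+m _ (length rest))))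

module LongestCycle {n : ℕ} (G : Graph n) {C : List (Fin n)} (C-longest : IsLongestCycle G C) where

  open Cycles G
  open DecMembership (_≟_ {n}) using (_∈?_)

  ⌊∈?⌋⇒∈ : ∀ {v} → ⌊ v ∈? C ⌋ ≡ true → v ∈ C
  ⌊∈?⌋⇒∈ {v} e with v ∈? C
  ... | yes v∈C = v∈C
  ... | no _    = case e of λ ()

  ⌊∈?⌋⇒∉ : ∀ {v} → ⌊ v ∈? C ⌋ ≡ false → v ∉ C
  ⌊∈?⌋⇒∉ {v} e with v ∈? C
  ... | no v∉C = v∉C
  ... | yes _  = case e of λ ()

  lookup-NC : ∀ z v → lookup (NC G C z) v ≡ adj G z v ∧ ⌊ v ∈? C ⌋
  lookup-NC z v = trans (lookup-zipWith _∧_ v (N G z) (VSet G C))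
    (cong₂ _∧_ (lookup∘tabulate (adj G z) v) (lookup∘tabulate (λ w → ⌊ w ∈? C ⌋) v))

  lookup-NC⁻ : ∀ {z v} → lookup (NC G C z) v ≡ true → Adj G z v × v ∈ C
  lookup-NC⁻ {z} {v} e = let zv , v∈C = ∧⁻ (trans (sym (lookup-NC z v)) e) in zv , ⌊∈?⌋⇒∈ v∈C

  CycleOn : List (Fin n) → Set
  CycleOn R = IsCycle G R × R ↭ C

  CycleOn-C : CycleOn C
  CycleOn-C = proj₁ C-longest , ↭-refl

  CycleOn-rotate : ∀ xs ys → CycleOn (xs ++ ys) → CycleOn (ys ++ xs)
  CycleOn-rotate xs ys (c , r) = IsCycle-rotate xs ys c , ↭-trans (↭.++-comm ys xs) r

  -- Rerouting the cycle through Q instead of mid gives a cycle, which is no longer than C.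
  detour-length : ∀ {a mid b rest Q} → CycleOn (a ∷ mid ++ b ∷ rest) →
    Unique Q → Linked (Adj G) (a ∷ Q ++ [ b ]) → All (_∉ C) Q → 1 ≤ length Q → length Q ≤ length mid
  detour-length {a} {mid} {b} {rest} {Q} R uQ lQ oQ 1≤Q =
    s≤s⁻¹ (+-cancelˡ-≤ (length rest) _ _ (subst₂ _≤_ (length-++ rest) (length-++ rest) (s≤s⁻¹ longer)))
    where
    R′ = CycleOn-rotate (a ∷ mid) (b ∷ rest) R
    arc : (b ∷ rest ++ [ a ]) ++ mid ≡ b ∷ rest ++ a ∷ mid
    arc = cong (b ∷_) (++-assoc rest [ a ] mid)
    arc-unique : Unique (b ∷ rest ++ [ a ])
    arc-unique = Unique-++⁻ˡ (b ∷ rest ++ [ a ]) (subst Unique (sym arc) (proj₁ (proj₁ R′)))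
    arc-linked : Linked (Adj G) (b ∷ rest ++ [ a ])
    arc-linked = Linked-++⁻ˡ (b ∷ rest ++ [ a ])
      (subst (Linked (Adj G)) (trans (cong (_++ [ b ]) (sym arc)) (++-assoc (b ∷ rest ++ [ a ]) mid [ b ]))
        (proj₁ (proj₂ (proj₁ R′))))
    arc⊆C : ∀ {v} → v ∈ b ∷ rest ++ [ a ] → v ∈ C
    arc⊆C {v} v∈ = ↭.∈-resp-↭ (proj₂ R′) (subst (v ∈_) arc (∈-++⁺ˡ v∈))
    longer : length (b ∷ rest ++ a ∷ Q) ≤ length (b ∷ rest ++ a ∷ mid)
    longer = subst (_ ≤_) (sym (↭.↭-length (proj₂ R′)))
      (proj₂ C-longest _ (IsCycle-close b rest a arc-unique arc-linked uQ lQ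
        (λ v∈Q v∈ → All.lookup oQ v∈Q (arc⊆C v∈)) 1≤Q))

  path-detour : ∀ {u mid w rest h t e} → CycleOn (u ∷ mid ++ w ∷ rest) → IsPathOutside G C (h ∷ t ++ [ e ]) →
    Adj G u h → Adj G e w → suc (length (t ++ [ e ])) ≤ length mid
  path-detour {w = w} {h = h} {t} {e} R ((uQ , lQ) , oQ) uh ew = detour-length R uQ
    (uh ∷ subst (λ z → Linked (Adj G) (h ∷ z)) (sym (++-assoc t [ e ] [ w ])) (Linked-join (h ∷ t) e lQ (ew ∷ [-])))
    oQ (s≤s z≤n)

  vertex-detour : ∀ {u mid w rest z} → CycleOn (u ∷ mid ++ w ∷ rest) → z ∉ C →
    Adj G u z → Adj G z w → 1 ≤ length mid
  vertex-detour R z∉C uz zw = detour-length R ([] ∷ []) (uz ∷ zw ∷ [-]) (z∉C ∷ []) (s≤s z≤n)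

  longestPath-end-neighbour : ∀ {z T v} → IsLongestPathOutside G C (z ∷ T) → Adj G z v → v ∈ C ⊎ v ∈ T
  longestPath-end-neighbour {z} {T} {v} (((u , l) , o) , longest) zv with v ∈? C | v ∈? (z ∷ T)
  ... | yes v∈C | _                 = inj₁ v∈C
  ... | no _    | yes (here refl)   = ⊥-elim (Adj-irrefl zv)
  ... | no _    | yes (there v∈T)   = inj₂ v∈T
  ... | no v∉C  | no v∉P            = contradiction (longest (v ∷ z ∷ T) longer) 1+n≰n
    where
    longer : IsPathOutside G C (v ∷ z ∷ T)
    longer = (All.¬Any⇒All¬ (z ∷ T) v∉P ∷ u , Adj-sym zv ∷ l) , v∉C ∷ o

  IsLongestPathOutside-reverse : ∀ {x pm y} → IsLongestPathOutside G C (x ∷ pm ++ [ y ]) →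
    IsLongestPathOutside G C (y ∷ reverse pm ++ [ x ])
  IsLongestPathOutside-reverse {x} {pm} {y} (((u , l) , o) , longest) =
    ((subst Unique reverse-eq (Unique-reverse u) , subst (Linked (Adj G)) reverse-eq (Linked-reverse Adj-sym l)) ,
     ↭.All-resp-↭ (subst ((x ∷ pm ++ [ y ]) ↭_) reverse-eq (↭-sym (↭.↭-reverse (x ∷ pm ++ [ y ])))) o) ,
    λ Q Q-outside → subst (_ ≤_) (sym (length-reverse-∷ʳ pm x y)) (longest Q Q-outside)
    where
    reverse-eq : reverse (x ∷ pm ++ [ y ]) ≡ y ∷ reverse pm ++ [ x ]
    reverse-eq = trans (reverse-++ (x ∷ pm) [ y ]) (cong (y ∷_) (unfold-reverse x pm))

  deg≤∣NC∣+length : ∀ {z T} → IsLongestPathOutside G C (z ∷ T) → deg G z ≤ ∣ NC G C z ∣ + length T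
  deg≤∣NC∣+length {z} {T} P = begin
    ∣ N G z ∣                                              ≡⟨ ∣p∣≡∣p∩q∣+∣p─q∣ (N G z) (VSet G C) ⟩
    ∣ NC G C z ∣ + ∣ N G z ─ VSet G C ∣                   ≤⟨ +-monoʳ-≤ _ (∣p∣≤count (N G z ─ VSet G C) T off-C⊆T) ⟩
    ∣ NC G C z ∣ + count (lookup (N G z ─ VSet G C)) T    ≤⟨ +-monoʳ-≤ _ (count≤length _ T) ⟩
    ∣ NC G C z ∣ + length T                                ∎
    where
    open ≤-Reasoning
    lookup-N∖VSet : ∀ v → lookup (N G z ─ VSet G C) v ≡ adj G z v ∧ not ⌊ v ∈? C ⌋
    lookup-N∖VSet v = trans (lookup-─ (N G z) (VSet G C) v)
      (cong₂ (λ a b → a ∧ not b) (lookup∘tabulate (adj G z) v) (lookup∘tabulate (λ w → ⌊ w ∈? C ⌋) v))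
    off-C⊆T : ∀ v → lookup (N G z ─ VSet G C) v ≡ true → v ∈ T
    off-C⊆T v e with ∧-not⁻ (trans (sym (lookup-N∖VSet v)) e)
    ... | zv , v∉C with longestPath-end-neighbour P zv
    ...   | inj₁ v∈C = contradiction v∈C (⌊∈?⌋⇒∉ v∉C)
    ...   | inj₂ v∈T = v∈T

module LongestCycleAndPath {n : ℕ} (G : Graph n) {C : List (Fin n)} (C-longest : IsLongestCycle G C)
  {x y : Fin n} {pm : List (Fin n)} (P-longest : IsLongestPathOutside G C (x ∷ pm ++ [ y ])) where

  open Cycles G
  open LongestCycle G C-longest

  p : ℕ
  p = length (pm ++ [ y ])

  A B : Subset n
  A = NC G C x
  B = NC G C y

  shared σ₁ σ₂ : ℕ
  shared = ∣ A ∩ B ∣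
  σ₁     = ∣ A ─ B ∣
  σ₂     = ∣ B ─ A ∣

  label : Fin n → Maybe Kind
  label v = classify (lookup A v) (lookup B v)

  open Labelling label
  open MixedGaps label

  lookup-A∩B : ∀ v → lookup (A ∩ B) v ≡ hasKind both (label v)
  lookup-A∩B v = trans (lookup-zipWith _∧_ v A B) (classify-∩ (lookup A v) (lookup B v))

  lookup-A─B : ∀ v → lookup (A ─ B) v ≡ hasKind onlyA (label v)
  lookup-A─B v = trans (lookup-─ A B v) (classify-─ (lookup A v) (lookup B v))

  lookup-B─A : ∀ v → lookup (B ─ A) v ≡ hasKind onlyB (label v)
  lookup-B─A v = trans (lookup-─ B A v) (classify-flip-─ (lookup A v) (lookup B v))

  P-reversed : IsLongestPathOutside G C (y ∷ reverse pm ++ [ x ])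
  P-reversed = IsLongestPathOutside-reverse P-longest

  x∉C : x ∉ C
  x∉C = All.head (proj₂ (proj₁ P-longest))

  y∉C : y ∉ C
  y∉C = All.head (proj₂ (proj₁ P-reversed))

  inA⇒Adj : ∀ {v k} → label v ≡ just k → inA k ≡ true → Adj G x v
  inA⇒Adj lv e = proj₁ (lookup-NC⁻ (trans (proj₁ (classify-just lv)) e))

  inB⇒Adj : ∀ {v k} → label v ≡ just k → inB k ≡ true → Adj G y v
  inB⇒Adj lv e = proj₁ (lookup-NC⁻ (trans (proj₂ (classify-just lv)) e))

  labelled⇒∈C : ∀ {v k} → label v ≡ just k → v ∈ C
  labelled⇒∈C {k = onlyA} lv = proj₂ (lookup-NC⁻ (proj₁ (classify-just lv)))
  labelled⇒∈C {k = onlyB} lv = proj₂ (lookup-NC⁻ (proj₂ (classify-just lv)))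
  labelled⇒∈C {k = both}  lv = proj₂ (lookup-NC⁻ (proj₁ (classify-just lv)))

  module _ {u mid w rest k l} (R : CycleOn (u ∷ mid ++ w ∷ rest)) (lu : label u ≡ just k) (lw : label w ≡ just l) where

    via-P : inA k ≡ true → inB l ≡ true → 2 + p ≤ suc (length mid)
    via-P a b = s≤s (path-detour R (proj₁ P-longest) (Adj-sym (inA⇒Adj lu a)) (inB⇒Adj lw b))

    via-P-reversed : inB k ≡ true → inA l ≡ true → 2 + p ≤ suc (length mid)
    via-P-reversed b a = s≤s (subst (λ m → suc m ≤ length mid) (length-reverse-∷ʳ pm x y)
      (path-detour R (proj₁ P-reversed) (Adj-sym (inB⇒Adj lu b)) (inA⇒Adj lw a)))

    via-x : inA k ≡ true → inA l ≡ true → 2 ≤ suc (length mid)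
    via-x a a′ = s≤s (vertex-detour R x∉C (Adj-sym (inA⇒Adj lu a)) (inA⇒Adj lw a′))

    via-y : inB k ≡ true → inB l ≡ true → 2 ≤ suc (length mid)
    via-y b b′ = s≤s (vertex-detour R y∉C (Adj-sym (inB⇒Adj lu b)) (inB⇒Adj lw b′))

  spacing≤arc : ∀ {u mid w rest k l} → CycleOn (u ∷ mid ++ w ∷ rest) → label u ≡ just k → label w ≡ just l →
    spacing p k l ≤ suc (length mid)
  spacing≤arc {k = onlyA} {onlyA} R lu lw = via-x R lu lw refl refl
  spacing≤arc {k = onlyA} {onlyB} R lu lw = via-P R lu lw refl refl
  spacing≤arc {k = onlyA} {both}  R lu lw = via-P R lu lw refl refl
  spacing≤arc {k = onlyB} {onlyA} R lu lw = via-P-reversed R lu lw refl refl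
  spacing≤arc {k = onlyB} {onlyB} R lu lw = via-y R lu lw refl refl
  spacing≤arc {k = onlyB} {both}  R lu lw = via-P-reversed R lu lw refl refl
  spacing≤arc {k = both}  {onlyA} R lu lw = via-P-reversed R lu lw refl refl
  spacing≤arc {k = both}  {onlyB} R lu lw = via-P R lu lw refl refl
  spacing≤arc {k = both}  {both}  R lu lw = via-P R lu lw refl refl

  CycleOn⇒Spaced : ∀ {R} → CycleOn R → Spaced (spacing p) R
  CycleOn⇒Spaced R-on pre u mid w post refl lu lw =
    spacing≤arc (subst CycleOn (cong (u ∷_) (++-assoc mid (w ∷ post) pre))
                  (CycleOn-rotate pre (u ∷ mid ++ w ∷ post) R-on)) lu lw

  mixed-pair⇒MixedGap : ∀ {u w k l} → u ∈ C → w ∈ C → u ≢ w →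
    label u ≡ just k → label w ≡ just l → mixed k l ≡ true → MixedGap C
  mixed-pair⇒MixedGap {k = k} {l} u∈C w∈C u≢w lu lw m with ∈-split u∈C w∈C u≢w
  ... | inj₁ (pre , mid , post , eq) = mixedGap pre _ mid _ post eq lu lw m
  ... | inj₂ (pre , mid , post , eq) = mixedGap pre _ mid _ post eq lw lu (trans (mixed-comm l k) m)

  label≡onlyA : ∀ {v} → lookup A v ≡ true → lookup B v ≡ false → label v ≡ just onlyA
  label≡onlyA av bv = cong₂ classify av bv

  label≡onlyB : ∀ {v} → lookup A v ≡ false → lookup B v ≡ true → label v ≡ just onlyB
  label≡onlyB av bv = cong₂ classify av bv

  mixed-with-onlyA : ∀ {w} → lookup B w ≡ true → ∃ λ l → label w ≡ just l × mixed onlyA l ≡ true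
  mixed-with-onlyA {w} bw with lookup A w
  ... | true  = both  , cong (classify true) bw , refl
  ... | false = onlyB , cong (classify false) bw , refl

  mixed-with-onlyB : ∀ {w} → lookup A w ≡ true → ∃ λ l → label w ≡ just l × mixed onlyB l ≡ true
  mixed-with-onlyB {w} aw with lookup B w
  ... | true  = both  , cong (λ a → classify a true) aw , refl
  ... | false = onlyA , cong (λ a → classify a false) aw , refl

  differing-vertex : A ≢ B →
    ∃ λ v → (lookup A v ≡ true × lookup B v ≡ false) ⊎ (lookup A v ≡ false × lookup B v ≡ true)
  differing-vertex A≢B with ≢⇒differing A B A≢B
  ... | v , d with lookup A v in av | lookup B v in bv
  ...   | true  | true  = ⊥-elim (d refl)
  ...   | true  | false = v , inj₁ (av , bv)
  ...   | false | true  = v , inj₂ (av , bv)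
  ...   | false | false = ⊥-elim (d refl)

  1≤σ₁⊔σ₂ : A ≢ B → 1 ≤ σ₁ ⊔ σ₂
  1≤σ₁⊔σ₂ A≢B with differing-vertex A≢B
  ... | v , inj₁ (av , bv) =
    ≤-trans (member⇒1≤∣p∣ (A ─ B) (trans (lookup-A─B v) (cong (hasKind onlyA) (label≡onlyA av bv)))) (m≤m⊔n σ₁ σ₂)
  ... | v , inj₂ (av , bv) =
    ≤-trans (member⇒1≤∣p∣ (B ─ A) (trans (lookup-B─A v) (cong (hasKind onlyB) (label≡onlyB av bv)))) (m≤n⊔m σ₁ σ₂)

  C-has-mixedGap : A ≢ B → 1 ≤ ∣ A ∣ → 1 ≤ ∣ B ∣ → MixedGap C
  C-has-mixedGap A≢B 1≤A 1≤B with differing-vertex A≢B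
  ... | v , inj₁ (av , bv) = let w , bw = 1≤∣p∣⇒member B 1≤B ; l , lw , m = mixed-with-onlyA bw in
    mixed-pair⇒MixedGap (labelled⇒∈C (label≡onlyA av bv)) (labelled⇒∈C lw)
      (λ { refl → case trans (sym bv) bw of λ () }) (label≡onlyA av bv) lw m
  ... | v , inj₂ (av , bv) = let w , aw = 1≤∣p∣⇒member A 1≤A ; l , lw , m = mixed-with-onlyB aw in
    mixed-pair⇒MixedGap (labelled⇒∈C (label≡onlyB av bv)) (labelled⇒∈C lw)
      (λ { refl → case trans (sym av) aw of λ () }) (label≡onlyB av bv) lw m

  module _ (g : MixedGap C) where

    open MixedGap g

    W₀ arc : List (Fin n)
    W₀  = post ++ pre
    arc = w ∷ W₀ ++ [ u ]

    -- C rotated to start at w; u is then its last labelled vertex.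
    R-on : CycleOn (w ∷ W₀ ++ u ∷ mid)
    R-on = subst CycleOn (cong (w ∷_) (sym (++-assoc post pre (u ∷ mid))))
      (CycleOn-rotate (pre ++ u ∷ mid) (w ∷ post)
        (subst CycleOn (trans split (sym (++-assoc pre (u ∷ mid) (w ∷ post)))) CycleOn-C))

    R≡arc++mid : w ∷ W₀ ++ u ∷ mid ≡ arc ++ mid
    R≡arc++mid = cong (w ∷_) (sym (++-assoc W₀ [ u ] mid))

    arc-weight : walkWeight (spacing p) l (mapMaybe label (W₀ ++ [ u ])) + (2 + p) ≤ length C
    arc-weight = begin
      walkWeight (spacing p) l (mapMaybe label (W₀ ++ [ u ])) + (2 + p)
        ≤⟨ +-mono-≤ (Spaced⇒walkWeight≤length (W₀ ++ [ u ]) label-w arc-spaced) closing ⟩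
      length (W₀ ++ [ u ]) + suc (length mid)   ≡⟨ +-suc _ (length mid) ⟩
      length arc + length mid                    ≡⟨ length-++ arc ⟨
      length (arc ++ mid)                        ≡⟨ cong length R≡arc++mid ⟨
      length (w ∷ W₀ ++ u ∷ mid)                 ≡⟨ ↭.↭-length (proj₂ R-on) ⟩
      length C                                   ∎
      where
      open ≤-Reasoning
      arc-spaced : Spaced (spacing p) arc
      arc-spaced = Spaced-++⁻ˡ arc (subst (Spaced (spacing p)) R≡arc++mid (CycleOn⇒Spaced R-on))
      closing : 2 + p ≤ suc (length mid)
      closing = subst (_≤ suc (length mid)) (spacing-mixed p {k} {l} kl-mixed)
        (spacing≤arc (CycleOn-rotate (w ∷ W₀) (u ∷ mid) R-on) label-u label-w)

    arc-word : mapMaybe label arc ≡ l ∷ mapMaybe label (W₀ ++ [ u ])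
    arc-word rewrite label-w = refl

    ∣S∣≤count-arc : ∀ (S : Subset n) k → (∀ v → lookup S v ≡ hasKind k (label v)) →
      ∣ S ∣ ≤ count (_== k) (l ∷ mapMaybe label (W₀ ++ [ u ]))
    ∣S∣≤count-arc S k S≡ = begin
      ∣ S ∣                                     ≤⟨ ∣p∣≤count S arc S⊆arc ⟩
      count (lookup S) arc                      ≤⟨ count-mono (λ v e → trans (sym (S≡ v)) e) arc ⟩
      count (hasKind k ∘ label) arc                  ≡⟨ count-mapMaybe k label arc ⟨
      count (_== k) (mapMaybe label arc)        ≡⟨ cong (count (_== k)) arc-word ⟩
      count (_== k) (l ∷ mapMaybe label (W₀ ++ [ u ])) ∎
      where
      open ≤-Reasoning
      S⊆arc : ∀ v → lookup S v ≡ true → v ∈ arc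
      S⊆arc v e with label v in lv | S≡ v
      ... | nothing | S≡v = case trans (sym S≡v) e of λ ()
      ... | just _  | _ with ∈-++⁻ arc (subst (v ∈_) R≡arc++mid
                                (↭.∈-resp-↭ (↭-sym (proj₂ R-on)) (labelled⇒∈C lv)))
      ...   | inj₁ v∈arc = v∈arc
      ...   | inj₂ v∈mid = case trans (sym lv) (All.lookup unlabelled v∈mid) of λ ()

    cycleLowerBound≤length : cycleLowerBound p shared σ₁ σ₂ ≤ length C
    cycleLowerBound≤length = begin
      cycleLowerBound p shared σ₁ σ₂
        ≤⟨ cycleLowerBound-mono p (∣S∣≤count-arc (A ∩ B) both lookup-A∩B) (∣S∣≤count-arc (A ─ B) onlyA lookup-A─B)
                                  (∣S∣≤count-arc (B ─ A) onlyB lookup-B─A) ⟩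
      cycleLowerBound p (#both ks) (#onlyA ks) (#onlyB ks)  ≤⟨ spacing-cyclic-lowerBound p l (mapMaybe label (W₀ ++ [ u ])) ⟩
      walkWeight (spacing p) l (mapMaybe label (W₀ ++ [ u ])) + (2 + p)  ≤⟨ arc-weight ⟩
      length C ∎
      where
      open ≤-Reasoning
      ks = l ∷ mapMaybe label (W₀ ++ [ u ])

  ∣A∣≡shared+σ₁ : ∣ A ∣ ≡ shared + σ₁
  ∣A∣≡shared+σ₁ = ∣p∣≡∣p∩q∣+∣p─q∣ A B

  ∣B∣≡shared+σ₂ : ∣ B ∣ ≡ shared + σ₂
  ∣B∣≡shared+σ₂ = trans (∣p∣≡∣p∩q∣+∣p─q∣ B A) (cong (λ S → ∣ S ∣ + σ₂) (∩-comm B A))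

  deg-x : deg G x ≤ shared + σ₁ + p
  deg-x = subst (λ m → deg G x ≤ m + p) ∣A∣≡shared+σ₁ (deg≤∣NC∣+length P-longest)

  deg-y : deg G y ≤ shared + σ₂ + p
  deg-y = subst₂ (λ m q → deg G y ≤ m + q) ∣B∣≡shared+σ₂ (length-reverse-∷ʳ pm x y) (deg≤∣NC∣+length P-reversed)

circumference-p≡1-ordered : ∀ {s α β δ c} → α ≤ β → 1 ≤ β →
  cycleLowerBound 1 s α β ≤ c → δ ≤ s + α + 1 → 3 * δ + β ≤ c + 1
circumference-p≡1-ordered {s} {zero} {suc b} {δ} {c} _ _ K d = begin
  3 * δ + suc b                      ≤⟨ +-monoˡ-≤ (suc b) (*-monoʳ-≤ 3 d) ⟩
  3 * (s + 0 + 1) + suc b            ≤⟨ m≤m+n _ b ⟩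
  3 * (s + 0 + 1) + suc b + b        ≡⟨ regroup s b ⟩
  cycleLowerBound 1 s 0 (suc b) + 1  ≤⟨ +-monoˡ-≤ 1 K ⟩
  c + 1                              ∎
  where
  open ≤-Reasoning
  regroup : ∀ s b → 3 * (s + 0 + 1) + suc b + b ≡ 3 * s + 2 * (0 + suc b) + 1 * (0 + 1) + 1
  regroup = solve-∀
circumference-p≡1-ordered {s} {suc a} {suc b} {δ} {c} a≤b _ K d with j , refl ← m≤n⇒∃[o]m+o≡n (s≤s⁻¹ a≤b) = begin
  3 * δ + suc (a + j)                         ≤⟨ +-monoˡ-≤ (suc (a + j)) (*-monoʳ-≤ 3 d) ⟩
  3 * (s + suc a + 1) + suc (a + j)           ≤⟨ m≤m+n _ j ⟩
  3 * (s + suc a + 1) + suc (a + j) + j       ≡⟨ regroup s a j ⟩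
  cycleLowerBound 1 s (suc a) (suc (a + j)) + 1 ≤⟨ +-monoˡ-≤ 1 K ⟩
  c + 1                                       ∎
  where
  open ≤-Reasoning
  regroup : ∀ s a j → 3 * (s + suc a + 1) + suc (a + j) + j ≡ 3 * s + 2 * (suc a + suc (a + j)) + 1 * (1 + 1) + 1
  regroup = solve-∀

circumference-p≡1 : ∀ {p s α β δ c} → p ≡ 1 → cycleLowerBound p s α β ≤ c →
  δ ≤ s + α + p → δ ≤ s + β + p → 1 ≤ α ⊔ β → 3 * δ + (α ⊔ β) ≤ c + 1
circumference-p≡1 {s = s} {α} {β} {δ} {c} refl K d₁ d₂ 1≤α⊔β with ≤-total α β
... | inj₁ α≤β = subst (λ m → 3 * δ + m ≤ c + 1) (sym (m≤n⇒m⊔n≡n α≤β))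
  (circumference-p≡1-ordered α≤β (subst (1 ≤_) (m≤n⇒m⊔n≡n α≤β) 1≤α⊔β) K d₁)
... | inj₂ β≤α = subst (λ m → 3 * δ + m ≤ c + 1) (sym (m≥n⇒m⊔n≡m β≤α))
  (circumference-p≡1-ordered β≤α (subst (1 ≤_) (m≥n⇒m⊔n≡m β≤α) 1≤α⊔β)
    (subst (_≤ c) (cycleLowerBound-comm 1 s α β) K) d₂)

circumference-p≥2-one-sided : ∀ {q s β δ c} → 2 ≤ s → 1 ≤ β →
  cycleLowerBound (2 + q) s 0 β ≤ c → δ ≤ s + 0 + (2 + q) → 4 * δ ≤ c + 2 * (2 + q)
circumference-p≥2-one-sided {q} {suc (suc t)} {suc b} {δ} {c} (s≤s (s≤s _)) (s≤s _) K d = begin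
  4 * δ                                                     ≤⟨ *-monoʳ-≤ 4 d ⟩
  4 * (2 + t + 0 + (2 + q))                                 ≤⟨ m≤m+n _ _ ⟩
  4 * (2 + t + 0 + (2 + q)) + (q + q * t + 2 * b)           ≡⟨ regroup q t b ⟩
  cycleLowerBound (2 + q) (2 + t) 0 (suc b) + 2 * (2 + q)   ≤⟨ +-monoˡ-≤ (2 * (2 + q)) K ⟩
  c + 2 * (2 + q)                                           ∎
  where
  open ≤-Reasoning
  regroup : ∀ q t b → 4 * (2 + t + 0 + (2 + q)) + (q + q * t + 2 * b)
                    ≡ (2 + (2 + q)) * (2 + t) + 2 * (0 + suc b) + (2 + q) * (0 + 1) + 2 * (2 + q)
  regroup = solve-∀

circumference-p≥2-two-sided : ∀ {q s a b δ c} → cycleLowerBound (2 + q) s (suc a) (suc b) ≤ c →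
  δ ≤ s + suc a + (2 + q) → δ ≤ s + suc b + (2 + q) → 4 * δ ≤ c + 2 * (2 + q)
circumference-p≥2-two-sided {q} {s} {a} {b} {δ} {c} K d₁ d₂ = begin
  4 * δ                                                       ≡⟨ double δ ⟩
  2 * δ + 2 * δ                                               ≤⟨ +-mono-≤ (*-monoʳ-≤ 2 d₁) (*-monoʳ-≤ 2 d₂) ⟩
  2 * (s + suc a + (2 + q)) + 2 * (s + suc b + (2 + q))       ≤⟨ m≤m+n _ (q * s) ⟩
  2 * (s + suc a + (2 + q)) + 2 * (s + suc b + (2 + q)) + q * s ≡⟨ regroup q s a b ⟩
  cycleLowerBound (2 + q) s (suc a) (suc b) + 2 * (2 + q)     ≤⟨ +-monoˡ-≤ (2 * (2 + q)) K ⟩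
  c + 2 * (2 + q)                                             ∎
  where
  open ≤-Reasoning
  double : ∀ δ → 4 * δ ≡ 2 * δ + 2 * δ
  double = solve-∀
  regroup : ∀ q s a b → 2 * (s + suc a + (2 + q)) + 2 * (s + suc b + (2 + q)) + q * s
                      ≡ (2 + (2 + q)) * s + 2 * (suc a + suc b) + (2 + q) * (1 + 1) + 2 * (2 + q)
  regroup = solve-∀

circumference-p≥2 : ∀ {p s α β δ c} → 2 ≤ p → cycleLowerBound p s α β ≤ c →
  δ ≤ s + α + p → δ ≤ s + β + p → 2 ≤ s + α → 2 ≤ s + β → 1 ≤ α ⊔ β → 4 * δ ≤ c + 2 * p
circumference-p≥2 {α = zero}  {zero}  _ _ _ _ _ _ ()
circumference-p≥2 {s = s} {zero}  {suc b} (s≤s (s≤s _)) K d₁ _ 2≤s _ _ =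
  circumference-p≥2-one-sided (subst (2 ≤_) (+-identityʳ s) 2≤s) (s≤s z≤n) K d₁
circumference-p≥2 {suc (suc q)} {s} {suc a} {zero} {c = c} (s≤s (s≤s _)) K _ d₂ _ 2≤s _ =
  circumference-p≥2-one-sided (subst (2 ≤_) (+-identityʳ s) 2≤s) (s≤s z≤n)
    (subst (_≤ c) (cycleLowerBound-comm (2 + q) s (suc a) 0) K) d₂
circumference-p≥2 {α = suc a} {suc b} (s≤s (s≤s _)) K d₁ d₂ _ _ _ = circumference-p≥2-two-sided K d₁ d₂

lemma1 : ∀ {n : ℕ} (G : Graph n) (δ c : ℕ) (C P : List (Fin n)) (x y : Fin n)
    → IsMinDegree G δ
    → IsCircumference G c
    → IsLongestCycle G C
    → IsLongestPathOutside G C P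
    → HasEnds G P x y
    → 1 ≤ pathLength G P
    → 2 ≤ ∣ NC G C x ∣
    → 2 ≤ ∣ NC G C y ∣
    → ¬ (NC G C x ≡ NC G C y)
    → (pathLength G P ≡ 1
        → (3 * δ + (∣ NC G C x ─ NC G C y ∣ ⊔ ∣ NC G C y ─ NC G C x ∣) ≤ c + 1)
          × (3 * δ + 1 ≤ 3 * δ + (∣ NC G C x ─ NC G C y ∣ ⊔ ∣ NC G C y ─ NC G C x ∣)))
      × (2 ≤ pathLength G P → 4 * δ ≤ c + 2 * pathLength G P)
lemma1 G δ c C P x y (δ≤deg , _) (_ , cycles≤c) C-longest P-longest (pm , refl) _ 2≤∣A∣ 2≤∣B∣ A≢B =
  (λ p≡1 → circumference-p≡1 {s = shared} {σ₁} {σ₂} p≡1 K d₁ d₂ 1≤σ , +-monoʳ-≤ (3 * δ) 1≤σ) ,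
  (λ 2≤p → circumference-p≥2 {s = shared} {σ₁} {σ₂} 2≤p K d₁ d₂
             (subst (2 ≤_) ∣A∣≡shared+σ₁ 2≤∣A∣) (subst (2 ≤_) ∣B∣≡shared+σ₂ 2≤∣B∣) 1≤σ)
  where
  open LongestCycleAndPath G C-longest P-longest
  K : cycleLowerBound p shared σ₁ σ₂ ≤ c
  K = ≤-trans (cycleLowerBound≤length
                (C-has-mixedGap A≢B (≤-trans (s≤s z≤n) 2≤∣A∣) (≤-trans (s≤s z≤n) 2≤∣B∣)))
              (cycles≤c C (proj₁ C-longest))
  d₁ : δ ≤ shared + σ₁ + p
  d₁ = ≤-trans (δ≤deg x) deg-x
  d₂ : δ ≤ shared + σ₂ + p
  d₂ = ≤-trans (δ≤deg y) deg-y
  1≤σ : 1 ≤ σ₁ ⊔ σ₂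
  1≤σ = 1≤σ₁⊔σ₂ A≢B
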